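{- For all sufficiently large $n$ and all integers $0\le q\le n^2/20$, we have $h_F(n,q)\le (q+1)^2\left(\frac{13n}{4}+13\right)$.
   Context: $F$ denotes the bowtie: the graph on 5 vertices consisting of two triangles sharing exactly one vertex. $\mathrm{ex}(n,F)$ is the maximum number of edges in an $F$-free graph on $n$ vertices (equal to $\lfloor n^2/4\rfloor+1$ for $n\ge5$). $\#F(H)$ is the number of subgraphs of $H$ isomorphic to $F$, and $h_F(n,q)=\min\{\#F(H): |V(H)|=n,\ |E(H)|=\mathrm{ex}(n,F)+q\}$. -}

module Defs where

open import Data.Nat using (ℕ; zero; suc; _+_; _*_; _<ᵇ_)
open import Data.Bool using (Bool; true; false; _∧_; if_then_else_)
open import Data.Fin using (Fin; toℕ)
open import Data.List using (List; map; allFin)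
open import Data.Nat.ListAction using (sum)
open import Relation.Binary.PropositionalEquality using (_≡_)

record Graph (n : ℕ) : Set where
  field
    adj    : Fin n → Fin n → Bool
    sym    : ∀ i j → adj i j ≡ adj j i
    irrefl : ∀ i → adj i i ≡ false
open Graph public

count : (n : ℕ) → (Fin n → Bool) → ℕ
count n p = sum (map (λ i → if p i then 1 else 0) (allFin n))

_<ᶠ_ : ∀ {n} → Fin n → Fin n → Bool
i <ᶠ j = toℕ i <ᵇ toℕ j

_≠ᶠ_ : ∀ {n} → Fin n → Fin n → Bool
i ≠ᶠ j = (i <ᶠ j) Data.Bool.∨ (j <ᶠ i)

edges : ∀ {n} → Graph n → ℕ
edges {n} G = sum (map (λ i → count n (λ j → (i <ᶠ j) ∧ adj G i j)) (allFin n))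

-- Is (c ; {a,b} ; {d,e}) a copy of the bowtie in G, written in canonical form:
-- c is the common vertex, a < b, d < e, a < d, all five vertices distinct,
-- and all six edges ca, cb, ab, cd, ce, de are present.
-- Every bowtie subgraph of G corresponds to exactly one such canonical tuple
-- (the centre is the unique vertex of degree 4 in the bowtie; the two
-- triangles are ordered by their smallest non-centre vertex).
isBowtie : ∀ {n} → Graph n → Fin n → Fin n → Fin n → Fin n → Fin n → Bool
isBowtie G c a b d e =
  (a <ᶠ b) ∧ (d <ᶠ e) ∧ (a <ᶠ d) ∧
  (c ≠ᶠ a) ∧ (c ≠ᶠ b) ∧ (c ≠ᶠ d) ∧ (c ≠ᶠ e) ∧
  (a ≠ᶠ e) ∧ (b ≠ᶠ d) ∧ (b ≠ᶠ e) ∧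
  adj G c a ∧ adj G c b ∧ adj G a b ∧ adj G c d ∧ adj G c e ∧ adj G d e

bowties : ∀ {n} → Graph n → ℕ
bowties {n} G =
  sum (map (λ c → sum (map (λ a → sum (map (λ b → sum (map (λ d →
    count n (λ e → isBowtie G c a b d e)) (allFin n))) (allFin n))) (allFin n))) (allFin n))

-- ex(n, F) = ⌊n²/4⌋ + 1  (valid for n ≥ 5, as recalled in the paper)
exBowtie : ℕ → ℕ
exBowtie n = (n * n) Data.Nat./ 4 + 1

-- Let h = ⌊n/2⌋ and split the remaining n - h = 2s + o vertices (o ≤ 1) into X and Y of size s
-- and o spare vertices. Joining the h hubs to all of them gives h (n - h) = ⌊n²/4⌋ edges; add a
-- bipartite graph H between X and Y with M = q + 1 = s k + r edges and all degrees at most k + 1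
-- (row x of its biadjacency matrix is a cyclic interval of length k or k + 1). The hubs are
-- independent and H is triangle-free, so every triangle is a hub plus an edge of H. A bowtie
-- centred at a hub is thus a pair of H-edges, at most M² of them, and one centred at a vertex v of
-- H consists of two hubs and two distinct H-neighbours of v, at most h² d(v) (d(v) - 1) ≤ h² k d(v)
-- of them. By the handshake lemma 4 #F ≤ 4 h M² + 8 h² k M, and 2h ≤ n, 4h ≤ 9s, s k ≤ M bound
-- this by 13 n M².

module Submission where

open import Defs using (Graph; edges; bowties; exBowtie)
open import Data.Bool using (Bool; true; false; T; not; _∧_; _∨_; if_then_else_)
open import Data.Bool.Properties using (∧-identityʳ; ∧-zeroʳ; ∨-identityʳ; T-∨)
open import Data.Empty using (⊥; ⊥-elim)
open import Data.Fin using (toℕ)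
open import Data.List using (map; allFin; tabulate)
open import Data.List.Properties using (map-tabulate)
open import Data.Nat
open import Data.Nat.DivMod
open import Data.Nat.ListAction using (sum)
open import Data.Nat.Properties
open import Data.Nat.Tactic.RingSolver using (solve-∀)
open import Data.Product using (Σ; _×_; _,_; proj₁; proj₂)
open import Data.Sum using (_⊎_; inj₁; inj₂; map₁)
open import Function using (_∘_; id)
open import Function.Bundles using (Equivalence)
open import Relation.Binary.Definitions using (tri<; tri≈; tri>)
open import Relation.Binary.PropositionalEquality
open import Relation.Nullary using (yes; no)
open import Algebra.Properties.CommutativeSemigroup +-commutativeSemigroup using ()
  renaming (interchange to +-interchange)
open import Algebra.Properties.CommutativeSemigroup *-commutativeSemigroup using ()
  renaming (interchange to *-interchange)

𝟙 : Bool → ℕ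
𝟙 b = if b then 1 else 0

_≠ᵇ_ : ℕ → ℕ → Bool
m ≠ᵇ n = (m <ᵇ n) ∨ (n <ᵇ m)

<ᵇ-true : ∀ {m n} → m < n → (m <ᵇ n) ≡ true
<ᵇ-true {zero}  {suc n} _         = refl
<ᵇ-true {suc m} {suc n} (s<s m<n) = <ᵇ-true m<n

<ᵇ-false : ∀ {m n} → n ≤ m → (m <ᵇ n) ≡ false
<ᵇ-false {m}     {zero}  _         = refl
<ᵇ-false {suc m} {suc n} (s≤s n≤m) = <ᵇ-false n≤m

𝟙-∧ : ∀ x y → 𝟙 (x ∧ y) ≡ 𝟙 x * 𝟙 y
𝟙-∧ true  y = sym (+-identityʳ (𝟙 y))
𝟙-∧ false y = refl

𝟙-mono-≤ : ∀ {x y} → (T x → T y) → 𝟙 x ≤ 𝟙 y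
𝟙-mono-≤ {false}         _   = z≤n
𝟙-mono-≤ {true}  {true}  _   = ≤-refl
𝟙-mono-≤ {true}  {false} x⇒y = ⊥-elim (x⇒y _)

+-<ᵇ : ∀ a m n → (a + m <ᵇ a + n) ≡ (m <ᵇ n)
+-<ᵇ zero    m n = refl
+-<ᵇ (suc a) m n = +-<ᵇ a m n

+-<ᵇ-∸ : ∀ a m n → (a + m <ᵇ n) ≡ (m <ᵇ n ∸ a)
+-<ᵇ-∸ zero    m n       = refl
+-<ᵇ-∸ (suc a) m zero    = refl
+-<ᵇ-∸ (suc a) m (suc n) = +-<ᵇ-∸ a m n

𝟙≤1 : ∀ b → 𝟙 b ≤ 1
𝟙≤1 false = z≤n
𝟙≤1 true  = ≤-refl

∧⁻ : ∀ x {y} → T (x ∧ y) → T x × T y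
∧⁻ true t = _ , t

∧⁺ : ∀ {x y} → T x → T y → T (x ∧ y)
∧⁺ {true} _ t = t

∧-mapʳ : ∀ x {y z} → (T y → T z) → T (x ∧ y) → T (x ∧ z)
∧-mapʳ true f = f

∀-<-+ : ∀ {P : ℕ → Set} m n → (∀ i → i < m → P i) → (∀ j → j < n → P (m + j)) → ∀ i → i < m + n → P i
∀-<-+ {P} m n low high i i<m+n with i <? m
... | yes i<m = low i i<m
... | no  i≮m = subst P (m+[n∸m]≡n (≮⇒≥ i≮m))
  (high (i ∸ m) (+-cancelˡ-< m _ _ (subst (_< m + n) (sym (m+[n∸m]≡n (≮⇒≥ i≮m))) i<m+n)))

∑ : ℕ → (ℕ → ℕ) → ℕ
∑ zero    f = 0
∑ (suc n) f = f 0 + ∑ n (f ∘ suc)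

infix 5 ∑
syntax ∑ n (λ i → e) = ∑[ i < n ] e

sum-allFin : ∀ n (f : ℕ → ℕ) → sum (map (f ∘ toℕ) (allFin n)) ≡ ∑ n f
sum-allFin n f = trans (cong sum (map-tabulate {n = n} id (f ∘ toℕ))) (sum-tabulate n f)
  where
  sum-tabulate : ∀ n (f : ℕ → ℕ) → sum (tabulate {n = n} (f ∘ toℕ)) ≡ ∑ n f
  sum-tabulate zero    f = refl
  sum-tabulate (suc n) f = cong (f 0 +_) (sum-tabulate n (f ∘ suc))

∑-cong : ∀ n {f g : ℕ → ℕ} → (∀ i → i < n → f i ≡ g i) → ∑ n f ≡ ∑ n g
∑-cong zero    eq = refl
∑-cong (suc n) eq = cong₂ _+_ (eq 0 z<s) (∑-cong n (λ i i<n → eq (suc i) (s<s i<n)))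

∑-mono-≤ : ∀ n {f g : ℕ → ℕ} → (∀ i → i < n → f i ≤ g i) → ∑ n f ≤ ∑ n g
∑-mono-≤ zero    le = z≤n
∑-mono-≤ (suc n) le = +-mono-≤ (le 0 z<s) (∑-mono-≤ n (λ i i<n → le (suc i) (s<s i<n)))

∑-+ : ∀ m n (f : ℕ → ℕ) → ∑ (m + n) f ≡ ∑ m f + (∑[ i < n ] f (m + i))
∑-+ zero    n f = refl
∑-+ (suc m) n f = trans (cong (f 0 +_) (∑-+ m n (f ∘ suc))) (sym (+-assoc (f 0) _ _))

∑-const : ∀ n c → ∑[ _ < n ] c ≡ n * c
∑-const zero    c = refl
∑-const (suc n) c = cong (c +_) (∑-const n c)

∑-zero : ∀ n {f : ℕ → ℕ} → (∀ i → i < n → f i ≡ 0) → ∑ n f ≡ 0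
∑-zero n eq = trans (∑-cong n eq) (trans (∑-const n 0) (*-zeroʳ n))

∑-distrib-+ : ∀ n (f g : ℕ → ℕ) → ∑[ i < n ] (f i + g i) ≡ ∑ n f + ∑ n g
∑-distrib-+ zero    f g = refl
∑-distrib-+ (suc n) f g =
  trans (cong (f 0 + g 0 +_) (∑-distrib-+ n (f ∘ suc) (g ∘ suc))) (+-interchange (f 0) (g 0) _ _)

*-distribˡ-∑ : ∀ n c (f : ℕ → ℕ) → ∑[ i < n ] (c * f i) ≡ c * ∑ n f
*-distribˡ-∑ zero    c f = sym (*-zeroʳ c)
*-distribˡ-∑ (suc n) c f =
  trans (cong (c * f 0 +_) (*-distribˡ-∑ n c (f ∘ suc))) (sym (*-distribˡ-+ c (f 0) _))

*-distribʳ-∑ : ∀ n c (f : ℕ → ℕ) → ∑[ i < n ] (f i * c) ≡ ∑ n f * c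
*-distribʳ-∑ n c f = begin
  ∑[ i < n ] (f i * c)  ≡⟨ ∑-cong n (λ i _ → *-comm (f i) c) ⟩
  ∑[ i < n ] (c * f i)  ≡⟨ *-distribˡ-∑ n c f ⟩
  c * ∑ n f             ≡⟨ *-comm c (∑ n f) ⟩
  ∑ n f * c             ∎
  where open ≡-Reasoning

∑-comm : ∀ m n (f : ℕ → ℕ → ℕ) → ∑[ i < m ] ∑[ j < n ] f i j ≡ ∑[ j < n ] ∑[ i < m ] f i j
∑-comm zero    n f = sym (∑-zero n (λ _ _ → refl))
∑-comm (suc m) n f = trans (cong (∑ n (f 0) +_) (∑-comm m n (f ∘ suc)))
  (sym (∑-distrib-+ n (f 0) (λ j → ∑[ i < m ] f (suc i) j)))

∑-product : ∀ m n (f g : ℕ → ℕ) → ∑[ i < m ] ∑[ j < n ] (f i * g j) ≡ ∑ m f * ∑ n g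
∑-product m n f g = trans (∑-cong m (λ i _ → *-distribˡ-∑ n (f i) g)) (*-distribʳ-∑ m (∑ n g) f)

sum-allFin-cong : ∀ n (f g : ℕ → ℕ) → (∀ i → f i ≡ g i) → sum (map (f ∘ toℕ) (allFin n)) ≡ ∑ n g
sum-allFin-cong n f g f≗g = trans (sum-allFin n f) (∑-cong n λ i _ → f≗g i)

∑-𝟙-< : ∀ n c → ∑[ i < n ] 𝟙 (i <ᵇ c) ≡ n ⊓ c
∑-𝟙-< zero    c       = refl
∑-𝟙-< (suc n) zero    = ∑-zero (suc n) λ _ _ → refl
∑-𝟙-< (suc n) (suc c) = cong suc (∑-𝟙-< n c)

∑-𝟙-remove : ∀ n (p : ℕ → Bool) {b} → b < n → T (p b) →
  suc (∑[ e < n ] 𝟙 (p e ∧ (b ≠ᵇ e))) ≡ ∑[ e < n ] 𝟙 (p e)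
∑-𝟙-remove (suc n) p {zero}  _         pb with p 0 | pb
... | true | _ = cong suc (∑-cong n λ e _ → cong 𝟙 (∧-identityʳ (p (suc e))))
∑-𝟙-remove (suc n) p {suc b} (s<s b<n) pb =
  trans (sym (+-suc (𝟙 (p 0 ∧ true)) _))
        (cong₂ _+_ (cong 𝟙 (∧-identityʳ (p 0))) (∑-𝟙-remove n (p ∘ suc) b<n pb))

record Adjacency : Set where
  field
    adjacent        : ℕ → ℕ → Bool
    adjacent-sym    : ∀ i j → adjacent i j ≡ adjacent j i
    adjacent-irrefl : ∀ i → adjacent i i ≡ false
open Adjacency public

toGraph : ∀ n → Adjacency → Graph n
toGraph n A = record
  { adj    = λ i j → adjacent A (toℕ i) (toℕ j)
  ; sym    = λ i j → adjacent-sym A (toℕ i) (toℕ j)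
  ; irrefl = λ i → adjacent-irrefl A (toℕ i)
  }

edgeCount : ℕ → Adjacency → ℕ
edgeCount n A = ∑[ i < n ] ∑[ j < n ] 𝟙 ((i <ᵇ j) ∧ adjacent A i j)

degree : ℕ → Adjacency → ℕ → ℕ
degree n A u = ∑[ v < n ] 𝟙 (adjacent A u v)

triangle : Adjacency → ℕ → ℕ → ℕ → Bool
triangle A c a b = (a <ᵇ b) ∧ (adjacent A c a ∧ (adjacent A c b ∧ adjacent A a b))

TriangleFree : Adjacency → Set
TriangleFree A = ∀ u v w → T (adjacent A u v) → T (adjacent A u w) → T (adjacent A v w) → ⊥

-- Defs.isBowtie read on ℕ, conjunct for conjunct, so that bowties (toGraph n A) unfolds to it.
isBowtieℕ : Adjacency → ℕ → ℕ → ℕ → ℕ → ℕ → Bool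
isBowtieℕ A c a b d e =
  (a <ᵇ b) ∧ (d <ᵇ e) ∧ (a <ᵇ d) ∧
  (c ≠ᵇ a) ∧ (c ≠ᵇ b) ∧ (c ≠ᵇ d) ∧ (c ≠ᵇ e) ∧
  (a ≠ᵇ e) ∧ (b ≠ᵇ d) ∧ (b ≠ᵇ e) ∧
  adjacent A c a ∧ adjacent A c b ∧ adjacent A a b ∧
  adjacent A c d ∧ adjacent A c e ∧ adjacent A d e

trianglesAt : ℕ → Adjacency → ℕ → ℕ
trianglesAt n A c = ∑[ a < n ] ∑[ b < n ] 𝟙 (triangle A c a b)

bowtiesAt : ℕ → Adjacency → ℕ → ℕ
bowtiesAt n A c = ∑[ a < n ] ∑[ b < n ] ∑[ d < n ] ∑[ e < n ] 𝟙 (isBowtieℕ A c a b d e)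

edges-toGraph : ∀ n A → edges (toGraph n A) ≡ edgeCount n A
edges-toGraph n A = sum-allFin-cong n _ _ λ i → sum-allFin n _

bowties-toGraph : ∀ n A → bowties (toGraph n A) ≡ ∑[ c < n ] bowtiesAt n A c
bowties-toGraph n A =
  sum-allFin-cong n _ _ λ c → sum-allFin-cong n _ _ λ a → sum-allFin-cong n _ _ λ b →
  sum-allFin-cong n _ _ λ d → sum-allFin n _

isBowtie⇒triangles : ∀ A c a b d e → T (isBowtieℕ A c a b d e) →
  T (triangle A c a b ∧ (triangle A c d e ∧ (b ≠ᵇ e)))
isBowtie⇒triangles A c a b d e t₀ =
  let a<b , t₁  = ∧⁻ (a <ᵇ b) t₀
      d<e , t₂  = ∧⁻ (d <ᵇ e) t₁
      _   , t₃  = ∧⁻ (a <ᵇ d) t₂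
      _   , t₄  = ∧⁻ (c ≠ᵇ a) t₃
      _   , t₅  = ∧⁻ (c ≠ᵇ b) t₄
      _   , t₆  = ∧⁻ (c ≠ᵇ d) t₅
      _   , t₇  = ∧⁻ (c ≠ᵇ e) t₆
      _   , t₈  = ∧⁻ (a ≠ᵇ e) t₇
      _   , t₉  = ∧⁻ (b ≠ᵇ d) t₈
      b≠e , t₁₀ = ∧⁻ (b ≠ᵇ e) t₉
      ca  , t₁₁ = ∧⁻ (adjacent A c a) t₁₀
      cb  , t₁₂ = ∧⁻ (adjacent A c b) t₁₁
      ab  , t₁₃ = ∧⁻ (adjacent A a b) t₁₂
      cd  , t₁₄ = ∧⁻ (adjacent A c d) t₁₃
      ce  , de  = ∧⁻ (adjacent A c e) t₁₄
  in ∧⁺ (∧⁺ a<b (∧⁺ ca (∧⁺ cb ab))) (∧⁺ (∧⁺ d<e (∧⁺ cd (∧⁺ ce de))) b≠e)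

bowtiesAt-≤ : ∀ n A c w →
  (∀ a b → b < n → T (triangle A c a b) → ∑[ d < n ] ∑[ e < n ] 𝟙 (triangle A c d e ∧ (b ≠ᵇ e)) ≤ w) →
  bowtiesAt n A c ≤ trianglesAt n A c * w
bowtiesAt-≤ n A c w bound = begin
  bowtiesAt n A c
    ≤⟨ ∑-mono-≤ n (λ a _ → ∑-mono-≤ n λ b _ → ∑-mono-≤ n λ d _ → ∑-mono-≤ n λ e _ →
         ≤-trans (𝟙-mono-≤ (isBowtie⇒triangles A c a b d e))
                 (≤-reflexive (𝟙-∧ (triangle A c a b) _))) ⟩
  (∑[ a < n ] ∑[ b < n ] ∑[ d < n ] ∑[ e < n ] 𝟙 (tri a b) * 𝟙 (tri d e ∧ (b ≠ᵇ e)))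
    ≡⟨ ∑-cong n (λ a _ → ∑-cong n λ b _ → trans (∑-cong n λ d _ → *-distribˡ-∑ n (𝟙 (tri a b)) _)
                                                  (*-distribˡ-∑ n (𝟙 (tri a b)) _)) ⟩
  (∑[ a < n ] ∑[ b < n ] 𝟙 (tri a b) * avoiding b)
    ≤⟨ ∑-mono-≤ n (λ a _ → ∑-mono-≤ n λ b b<n → 𝟙-*-mono-≤ (tri a b) (bound a b b<n)) ⟩
  (∑[ a < n ] ∑[ b < n ] 𝟙 (tri a b) * w)
    ≡⟨ trans (∑-cong n λ a _ → *-distribʳ-∑ n w _) (*-distribʳ-∑ n w _) ⟩
  trianglesAt n A c * w ∎
  where
  open ≤-Reasoning
  tri : ℕ → ℕ → Bool
  tri = triangle A c
  avoiding : ℕ → ℕ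
  avoiding b = ∑[ d < n ] ∑[ e < n ] 𝟙 (tri d e ∧ (b ≠ᵇ e))
  𝟙-*-mono-≤ : ∀ x {m o} → (T x → m ≤ o) → 𝟙 x * m ≤ 𝟙 x * o
  𝟙-*-mono-≤ false _   = z≤n
  𝟙-*-mono-≤ true  m≤o = +-monoˡ-≤ 0 (m≤o _)

handshake : ∀ n A → ∑[ u < n ] degree n A u ≡ 2 * edgeCount n A
handshake n A = begin
  (∑[ u < n ] ∑[ v < n ] 𝟙 (adjacent A u v))
    ≡⟨ ∑-cong n (λ u _ → trans (∑-cong n λ v _ → 𝟙-adjacent-split u v) (∑-distrib-+ n _ _)) ⟩
  (∑[ u < n ] ((∑[ v < n ] 𝟙 (below u v)) + (∑[ v < n ] 𝟙 (below v u))))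
    ≡⟨ ∑-distrib-+ n _ _ ⟩
  edgeCount n A + (∑[ u < n ] ∑[ v < n ] 𝟙 (below v u))
    ≡⟨ cong (edgeCount n A +_) (∑-comm n n λ u v → 𝟙 (below v u)) ⟩
  edgeCount n A + edgeCount n A
    ≡⟨ cong (edgeCount n A +_) (sym (+-identityʳ (edgeCount n A))) ⟩
  2 * edgeCount n A ∎
  where
  open ≡-Reasoning
  below : ℕ → ℕ → Bool
  below u v = (u <ᵇ v) ∧ adjacent A u v
  𝟙-adjacent-split : ∀ u v → 𝟙 (adjacent A u v) ≡ 𝟙 (below u v) + 𝟙 (below v u)
  𝟙-adjacent-split u v with <-cmp u v
  ... | tri< u<v _ _ rewrite <ᵇ-true u<v | <ᵇ-false (<⇒≤ u<v) = sym (+-identityʳ _)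
  ... | tri≈ _ refl _ rewrite <ᵇ-false (≤-refl {u}) | adjacent-irrefl A u = refl
  ... | tri> _ _ v<u rewrite <ᵇ-false (<⇒≤ v<u) | <ᵇ-true v<u = cong 𝟙 (adjacent-sym A u v)

∑-degree*[degree∸1]-≤ : ∀ n A k → (∀ u → u < n → degree n A u ≤ suc k) →
  ∑[ u < n ] degree n A u * (degree n A u ∸ 1) ≤ k * (2 * edgeCount n A)
∑-degree*[degree∸1]-≤ n A k deg≤ = begin
  (∑[ u < n ] deg u * (deg u ∸ 1))
    ≤⟨ ∑-mono-≤ n (λ u u<n → ≤-trans (*-monoʳ-≤ (deg u) (∸-monoˡ-≤ 1 (deg≤ u u<n))) (≤-reflexive (*-comm (deg u) k))) ⟩
  (∑[ u < n ] k * deg u)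
    ≡⟨ *-distribˡ-∑ n k deg ⟩
  k * (∑[ u < n ] deg u)
    ≡⟨ cong (k *_) (handshake n A) ⟩
  k * (2 * edgeCount n A) ∎
  where
  open ≤-Reasoning
  deg : ℕ → ℕ
  deg = degree n A

splitAt : ℕ → ℕ → ℕ ⊎ ℕ
splitAt zero    i       = inj₂ i
splitAt (suc h) zero    = inj₁ zero
splitAt (suc h) (suc i) = map₁ suc (splitAt h i)

splitAt-< : ∀ {h i} → i < h → splitAt h i ≡ inj₁ i
splitAt-< {suc h} {zero}  _         = refl
splitAt-< {suc h} {suc i} (s<s i<h) = cong (map₁ suc) (splitAt-< i<h)

splitAt-+ : ∀ h u → splitAt h (h + u) ≡ inj₂ u
splitAt-+ zero    u = refl
splitAt-+ (suc h) u = cong (map₁ suc) (splitAt-+ h u)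

splitAt≡inj₁⇒< : ∀ h i {j} → splitAt h i ≡ inj₁ j → i < h
splitAt≡inj₁⇒< (suc h) zero    _  = z<s
splitAt≡inj₁⇒< (suc h) (suc i) eq with splitAt h i in eq′
... | inj₁ _ = s<s (splitAt≡inj₁⇒< h i eq′)

splitAt≡inj₂⇒≥ : ∀ h i {u} → splitAt h i ≡ inj₂ u → h ≤ i
splitAt≡inj₂⇒≥ zero    i       _  = z≤n
splitAt≡inj₂⇒≥ (suc h) (suc i) eq with splitAt h i in eq′
... | inj₂ _ = s≤s (splitAt≡inj₂⇒≥ h i eq′)

∑-splitAt : ∀ h m (g : ℕ ⊎ ℕ → ℕ → ℕ) →
  ∑[ i < h + m ] g (splitAt h i) i ≡ (∑[ i < h ] g (inj₁ i) i) + (∑[ u < m ] g (inj₂ u) (h + u))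
∑-splitAt h m g = trans (∑-+ h m _)
  (cong₂ _+_ (∑-cong h λ i i<h → cong (λ σ → g σ i) (splitAt-< i<h))
             (∑-cong m λ u _ → cong (λ σ → g σ (h + u)) (splitAt-+ h u)))

∑-pairs-splitAt : ∀ h m (g : ℕ ⊎ ℕ → ℕ ⊎ ℕ → Bool) →
  ∑[ i < h + m ] ∑[ j < h + m ] 𝟙 ((i <ᵇ j) ∧ g (splitAt h i) (splitAt h j))
  ≡ (∑[ i < h ] ∑[ j < h ] 𝟙 ((i <ᵇ j) ∧ g (inj₁ i) (inj₁ j)))
    + ((∑[ i < h ] ∑[ v < m ] 𝟙 (g (inj₁ i) (inj₂ v)))
    + (∑[ u < m ] ∑[ v < m ] 𝟙 ((u <ᵇ v) ∧ g (inj₂ u) (inj₂ v))))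
∑-pairs-splitAt h m g = begin
  ∑[ i < h + m ] row (splitAt h i) i
    ≡⟨ ∑-splitAt h m row ⟩
  (∑[ i < h ] row (inj₁ i) i) + (∑[ u < m ] row (inj₂ u) (h + u))
    ≡⟨ cong₂ _+_ (trans (∑-cong h λ i i<h → hub-row i<h) (∑-distrib-+ h _ _))
                 (∑-cong m λ u _ → leaf-row u) ⟩
  hubs + cross + leaves
    ≡⟨ +-assoc hubs cross leaves ⟩
  hubs + (cross + leaves) ∎
  where
  open ≡-Reasoning
  hubs cross leaves : ℕ
  hubs   = ∑[ i < h ] ∑[ j < h ] 𝟙 ((i <ᵇ j) ∧ g (inj₁ i) (inj₁ j))
  cross  = ∑[ i < h ] ∑[ v < m ] 𝟙 (g (inj₁ i) (inj₂ v))
  leaves = ∑[ u < m ] ∑[ v < m ] 𝟙 ((u <ᵇ v) ∧ g (inj₂ u) (inj₂ v))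
  row : ℕ ⊎ ℕ → ℕ → ℕ
  row σ i = ∑[ j < h + m ] 𝟙 ((i <ᵇ j) ∧ g σ (splitAt h j))
  hub-row : ∀ {i} → i < h → row (inj₁ i) i ≡
    (∑[ j < h ] 𝟙 ((i <ᵇ j) ∧ g (inj₁ i) (inj₁ j))) + (∑[ v < m ] 𝟙 (g (inj₁ i) (inj₂ v)))
  hub-row {i} i<h = trans (∑-splitAt h m λ τ j → 𝟙 ((i <ᵇ j) ∧ g (inj₁ i) τ))
    (cong ((∑[ j < h ] 𝟙 ((i <ᵇ j) ∧ g (inj₁ i) (inj₁ j))) +_)
          (∑-cong m λ v _ → cong (λ b → 𝟙 (b ∧ g (inj₁ i) (inj₂ v))) (<ᵇ-true (<-≤-trans i<h (m≤m+n h v)))))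
  leaf-row : ∀ u → row (inj₂ u) (h + u) ≡ ∑[ v < m ] 𝟙 ((u <ᵇ v) ∧ g (inj₂ u) (inj₂ v))
  leaf-row u = trans (∑-splitAt h m λ τ j → 𝟙 ((h + u <ᵇ j) ∧ g (inj₂ u) τ))
    (cong₂ _+_ (∑-zero h λ j j<h → cong (λ b → 𝟙 (b ∧ g (inj₂ u) (inj₁ j))) (<ᵇ-false (≤-trans (<⇒≤ j<h) (m≤m+n h u))))
               (∑-cong m λ v _ → cong (λ b → 𝟙 (b ∧ g (inj₂ u) (inj₂ v))) (+-<ᵇ h u v)))

-- The vertices i < h are the hubs (splitAt h i = inj₁ i); vertex h + u is vertex u of L.
module Join (h m : ℕ) (L : Adjacency) where

  link : ℕ ⊎ ℕ → ℕ ⊎ ℕ → Bool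
  link (inj₁ _) (inj₁ _) = false
  link (inj₁ _) (inj₂ _) = true
  link (inj₂ _) (inj₁ _) = true
  link (inj₂ u) (inj₂ v) = adjacent L u v

  link-sym : ∀ σ τ → link σ τ ≡ link τ σ
  link-sym (inj₁ _) (inj₁ _) = refl
  link-sym (inj₁ _) (inj₂ _) = refl
  link-sym (inj₂ _) (inj₁ _) = refl
  link-sym (inj₂ u) (inj₂ v) = adjacent-sym L u v

  link-irrefl : ∀ σ → link σ σ ≡ false
  link-irrefl (inj₁ _) = refl
  link-irrefl (inj₂ u) = adjacent-irrefl L u

  join : Adjacency
  join = record
    { adjacent        = λ i j → link (splitAt h i) (splitAt h j)
    ; adjacent-sym    = λ i j → link-sym (splitAt h i) (splitAt h j)
    ; adjacent-irrefl = λ i → link-irrefl (splitAt h i)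
    }

  edgeCount-join : edgeCount (h + m) join ≡ h * m + edgeCount m L
  edgeCount-join = trans (∑-pairs-splitAt h m link)
    (cong₂ _+_ (∑-zero h λ i _ → ∑-zero h λ j _ → cong 𝟙 (∧-zeroʳ (i <ᵇ j)))
               (cong (_+ edgeCount m L) (trans (∑-cong h λ _ _ → trans (∑-const m 1) (*-identityʳ m)) (∑-const h m))))

  hub? : ℕ ⊎ ℕ → Bool
  hub? (inj₁ _) = true
  hub? (inj₂ _) = false

  leafLink : ℕ ⊎ ℕ → ℕ ⊎ ℕ → Bool
  leafLink (inj₂ u) (inj₂ v) = adjacent L u v
  leafLink _        _        = false

  linkTriangle : ℕ ⊎ ℕ → ℕ ⊎ ℕ → ℕ ⊎ ℕ → Bool
  linkTriangle σ τ υ = link σ τ ∧ (link σ υ ∧ link τ υ)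

  hub-triangle : ∀ {c a b} → c < h → T (triangle join c a b) →
    T ((a <ᵇ b) ∧ leafLink (splitAt h a) (splitAt h b))
  hub-triangle {c} {a} {b} c<h = ∧-mapʳ (a <ᵇ b)
    (both-leaves (splitAt h a) (splitAt h b) ∘ subst (λ σ → T (linkTriangle σ (splitAt h a) (splitAt h b))) (splitAt-< c<h))
    where
    both-leaves : ∀ σ τ → T (linkTriangle (inj₁ c) σ τ) → T (leafLink σ τ)
    both-leaves (inj₂ _) (inj₂ _) t = t

  -- Hubs precede leaves, so the smaller vertex of a triangle at a leaf is its hub.
  leaf-triangle : TriangleFree L → ∀ u {a b} → T (triangle join (h + u) a b) →
    T (hub? (splitAt h a)) × T (leafLink (inj₂ u) (splitAt h b))
  leaf-triangle free u {a} {b} t with a<b , t′ ← ∧⁻ (a <ᵇ b) t =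
    sides (splitAt h a) (splitAt h b) refl refl (subst (λ σ → T (linkTriangle σ (splitAt h a) (splitAt h b))) (splitAt-+ h u) t′)
    where
    sides : ∀ σ τ → splitAt h a ≡ σ → splitAt h b ≡ τ → T (linkTriangle (inj₂ u) σ τ) →
      T (hub? σ) × T (leafLink (inj₂ u) τ)
    sides (inj₁ _) (inj₂ v) _ _ t = _ , proj₁ (∧⁻ (adjacent L u v) t)
    sides (inj₂ _) (inj₁ _) a-leaf b-hub _ =
      ⊥-elim (<-asym (<ᵇ⇒< a b a<b) (<-≤-trans (splitAt≡inj₁⇒< h b b-hub) (splitAt≡inj₂⇒≥ h a a-leaf)))
    sides (inj₂ w) (inj₂ v) _ _ t with uw , t ← ∧⁻ (adjacent L u w) t with uv , wv ← ∧⁻ (adjacent L u v) t =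
      ⊥-elim (free u w v uw uv wv)

  ∑-hub? : ∑[ a < h + m ] 𝟙 (hub? (splitAt h a)) ≡ h
  ∑-hub? = trans (∑-splitAt h m λ σ _ → 𝟙 (hub? σ))
    (trans (cong₂ _+_ (trans (∑-const h 1) (*-identityʳ h)) (∑-zero m λ _ _ → refl)) (+-identityʳ h))

  ∑-leafLink : ∀ u → ∑[ b < h + m ] 𝟙 (leafLink (inj₂ u) (splitAt h b)) ≡ degree m L u
  ∑-leafLink u = trans (∑-splitAt h m λ τ _ → 𝟙 (leafLink (inj₂ u) τ))
    (cong (_+ degree m L u) (∑-zero h λ _ _ → refl))

  trianglesAt-hub : ∀ {c} → c < h → trianglesAt (h + m) join c ≤ edgeCount m L
  trianglesAt-hub c<h = ≤-trans
    (∑-mono-≤ (h + m) λ a _ → ∑-mono-≤ (h + m) λ b _ → 𝟙-mono-≤ (hub-triangle c<h))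
    (≤-reflexive (trans (∑-pairs-splitAt h m leafLink)
      (cong₂ _+_ (∑-zero h λ i _ → ∑-zero h λ j _ → cong 𝟙 (∧-zeroʳ (i <ᵇ j)))
                 (cong (_+ edgeCount m L) (∑-zero h λ _ _ → ∑-zero m λ _ _ → refl)))))

  bowtiesAt-hub : ∀ {c} → c < h → bowtiesAt (h + m) join c ≤ edgeCount m L * edgeCount m L
  bowtiesAt-hub {c} c<h = ≤-trans
    (bowtiesAt-≤ (h + m) join c (edgeCount m L) λ _ _ _ _ → ≤-trans
      (∑-mono-≤ (h + m) λ d _ → ∑-mono-≤ (h + m) λ e _ → 𝟙-mono-≤ (proj₁ ∘ ∧⁻ (triangle join c d e)))
      (trianglesAt-hub c<h))
    (*-monoˡ-≤ (edgeCount m L) (trianglesAt-hub c<h))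

  bowtiesAt-leaf : TriangleFree L → ∀ u →
    bowtiesAt (h + m) join (h + u) ≤ h * h * (degree m L u * (degree m L u ∸ 1))
  bowtiesAt-leaf free u = begin
    bowtiesAt (h + m) join c
      ≤⟨ bowtiesAt-≤ (h + m) join c (h * (D ∸ 1)) avoiding-≤ ⟩
    trianglesAt (h + m) join c * (h * (D ∸ 1))
      ≤⟨ *-monoˡ-≤ (h * (D ∸ 1)) triangles-≤ ⟩
    h * D * (h * (D ∸ 1))
      ≡⟨ *-interchange h D h (D ∸ 1) ⟩
    h * h * (D * (D ∸ 1)) ∎
    where
    open ≤-Reasoning
    c D : ℕ
    c = h + u
    D = degree m L u
    n = h + m
    nbr : ℕ → Bool
    nbr b = leafLink (inj₂ u) (splitAt h b)
    triangles-≤ : trianglesAt n join c ≤ h * D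
    triangles-≤ = begin
      trianglesAt n join c
        ≤⟨ ∑-mono-≤ n (λ a _ → ∑-mono-≤ n λ b _ → ≤-trans
             (𝟙-mono-≤ (λ t → let a-hub , b-nbr = leaf-triangle free u t in ∧⁺ a-hub b-nbr))
             (≤-reflexive (𝟙-∧ (hub? (splitAt h a)) (nbr b)))) ⟩
      (∑[ a < n ] ∑[ b < n ] 𝟙 (hub? (splitAt h a)) * 𝟙 (nbr b))
        ≡⟨ ∑-product n n _ _ ⟩
      (∑[ a < n ] 𝟙 (hub? (splitAt h a))) * (∑[ b < n ] 𝟙 (nbr b))
        ≡⟨ cong₂ _*_ ∑-hub? (∑-leafLink u) ⟩
      h * D ∎
    avoiding-≤ : ∀ a b → b < n → T (triangle join c a b) →
      ∑[ d < n ] ∑[ e < n ] 𝟙 (triangle join c d e ∧ (b ≠ᵇ e)) ≤ h * (D ∸ 1)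
    avoiding-≤ a b b<n t = begin
      (∑[ d < n ] ∑[ e < n ] 𝟙 (triangle join c d e ∧ (b ≠ᵇ e)))
        ≤⟨ ∑-mono-≤ n (λ d _ → ∑-mono-≤ n λ e _ → ≤-trans
             (𝟙-mono-≤ (λ t → let de , b≠e = ∧⁻ (triangle join c d e) t
                                  d-hub , e-nbr = leaf-triangle free u de
                              in ∧⁺ d-hub (∧⁺ e-nbr b≠e)))
             (≤-reflexive (𝟙-∧ (hub? (splitAt h d)) _))) ⟩
      (∑[ d < n ] ∑[ e < n ] 𝟙 (hub? (splitAt h d)) * 𝟙 (nbr e ∧ (b ≠ᵇ e)))
        ≡⟨ ∑-product n n _ _ ⟩
      (∑[ d < n ] 𝟙 (hub? (splitAt h d))) * (∑[ e < n ] 𝟙 (nbr e ∧ (b ≠ᵇ e)))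
        ≡⟨ cong₂ _*_ ∑-hub? (cong pred (trans (∑-𝟙-remove n nbr b<n (proj₂ (leaf-triangle free u t))) (∑-leafLink u))) ⟩
      h * (D ∸ 1) ∎

  bowties-join-≤ : TriangleFree L →
    ∑[ c < h + m ] bowtiesAt (h + m) join c
      ≤ h * (edgeCount m L * edgeCount m L) + h * h * (∑[ u < m ] degree m L u * (degree m L u ∸ 1))
  bowties-join-≤ free = begin
    ∑[ c < h + m ] bowtiesAt (h + m) join c
      ≡⟨ ∑-+ h m _ ⟩
    (∑[ c < h ] bowtiesAt (h + m) join c) + (∑[ u < m ] bowtiesAt (h + m) join (h + u))
      ≤⟨ +-mono-≤ (∑-mono-≤ h λ c c<h → bowtiesAt-hub c<h) (∑-mono-≤ m λ u _ → bowtiesAt-leaf free u) ⟩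
    (∑[ c < h ] edgeCount m L * edgeCount m L) + (∑[ u < m ] h * h * (degree m L u * (degree m L u ∸ 1)))
      ≡⟨ cong₂ _+_ (∑-const h _) (*-distribˡ-∑ m (h * h) _) ⟩
    h * (edgeCount m L * edgeCount m L) + h * h * (∑[ u < m ] degree m L u * (degree m L u ∸ 1)) ∎
    where open ≤-Reasoning

module Bipartite (p q : ℕ) (R : ℕ → ℕ → Bool) where

  cross : ℕ ⊎ ℕ → ℕ ⊎ ℕ → Bool
  cross (inj₁ x) (inj₂ y) = R x y
  cross (inj₂ y) (inj₁ x) = R x y
  cross _        _        = false

  cross-sym : ∀ σ τ → cross σ τ ≡ cross τ σ
  cross-sym (inj₁ _) (inj₁ _) = refl
  cross-sym (inj₁ _) (inj₂ _) = refl
  cross-sym (inj₂ _) (inj₁ _) = refl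
  cross-sym (inj₂ _) (inj₂ _) = refl

  cross-irrefl : ∀ σ → cross σ σ ≡ false
  cross-irrefl (inj₁ _) = refl
  cross-irrefl (inj₂ _) = refl

  bipartite : Adjacency
  bipartite = record
    { adjacent        = λ u v → cross (splitAt p u) (splitAt p v)
    ; adjacent-sym    = λ u v → cross-sym (splitAt p u) (splitAt p v)
    ; adjacent-irrefl = λ u → cross-irrefl (splitAt p u)
    }

  bipartite-triangleFree : TriangleFree bipartite
  bipartite-triangleFree u v w = sides (splitAt p u) (splitAt p v) (splitAt p w)
    where
    sides : ∀ σ τ υ → T (cross σ τ) → T (cross σ υ) → T (cross τ υ) → ⊥
    sides (inj₁ _) (inj₂ _) (inj₂ _) _ _ ()
    sides (inj₂ _) (inj₁ _) (inj₁ _) _ _ ()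

  edgeCount-bipartite : edgeCount (p + q) bipartite ≡ ∑[ x < p ] ∑[ y < q ] 𝟙 (R x y)
  edgeCount-bipartite = trans (∑-pairs-splitAt p q cross)
    (trans (cong₂ _+_ (∑-zero p λ i _ → ∑-zero p λ j _ → cong 𝟙 (∧-zeroʳ (i <ᵇ j)))
                      (cong ((∑[ x < p ] ∑[ y < q ] 𝟙 (R x y)) +_) (∑-zero q λ u _ → ∑-zero q λ v _ → cong 𝟙 (∧-zeroʳ (u <ᵇ v)))))
           (+-identityʳ _))

  degree-bipartite-≤ : ∀ D →
    (∀ x → x < p → ∑[ y < q ] 𝟙 (R x y) ≤ D) → (∀ y → y < q → ∑[ x < p ] 𝟙 (R x y) ≤ D) →
    ∀ u → u < p + q → degree (p + q) bipartite u ≤ D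
  degree-bipartite-≤ D row≤ col≤ = ∀-<-+ p q
    (λ x x<p → subst (_≤ D) (sym (trans (cong crossings (splitAt-< x<p)) (row x))) (row≤ x x<p))
    (λ y y<q → subst (_≤ D) (sym (trans (cong crossings (splitAt-+ p y)) (column y))) (col≤ y y<q))
    where
    crossings : ℕ ⊎ ℕ → ℕ
    crossings σ = ∑[ v < p + q ] 𝟙 (cross σ (splitAt p v))
    row : ∀ x → crossings (inj₁ x) ≡ ∑[ y < q ] 𝟙 (R x y)
    row x = trans (∑-splitAt p q λ τ _ → 𝟙 (cross (inj₁ x) τ)) (cong (_+ (∑[ y < q ] 𝟙 (R x y))) (∑-zero p λ _ _ → refl))
    column : ∀ y → crossings (inj₂ y) ≡ ∑[ x < p ] 𝟙 (R x y)
    column y = trans (∑-splitAt p q λ τ _ → 𝟙 (cross (inj₂ y) τ))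
      (trans (cong ((∑[ x < p ] 𝟙 (R x y)) +_) (∑-zero q λ _ _ → refl)) (+-identityʳ _))

-- For t < 2 s, window s K t holds iff t mod s < K.
window : ℕ → ℕ → ℕ → Bool
window s K t = (t <ᵇ K) ∨ (not (t <ᵇ s) ∧ (t <ᵇ s + K))

window-mono : ∀ s {K K′} t → K ≤ K′ → T (window s K t) → T (window s K′ t)
window-mono s {K} {K′} t K≤K′ w with t <ᵇ K in t<K
... | true  = Equivalence.from T-∨ (inj₁ (<⇒<ᵇ (<-≤-trans (<ᵇ⇒< t K (subst T (sym t<K) _)) K≤K′)))
... | false with t≥s , t<s+K ← ∧⁻ (not (t <ᵇ s)) w =
  Equivalence.from T-∨ (inj₂ (∧⁺ t≥s (<⇒<ᵇ (<-≤-trans (<ᵇ⇒< t (s + K) t<s+K) (+-monoʳ-≤ s K≤K′)))))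

∑-window : ∀ s K x → x ≤ s → K ≤ s → ∑[ y < s ] 𝟙 (window s K (x + y)) ≡ K
∑-window s K x x≤s K≤s = begin
  ∑[ y < s ] 𝟙 (window s K (x + y))
    ≡⟨ cong (λ l → ∑[ y < l ] 𝟙 (window s K (x + y))) (sym (m∸n+n≡m x≤s)) ⟩
  ∑[ y < (s ∸ x) + x ] 𝟙 (window s K (x + y))
    ≡⟨ ∑-+ (s ∸ x) x _ ⟩
  (∑[ y < s ∸ x ] 𝟙 (window s K (x + y))) + (∑[ y < x ] 𝟙 (window s K (x + (s ∸ x + y))))
    ≡⟨ cong₂ _+_ (∑-cong (s ∸ x) λ y y<s∸x → cong 𝟙 (below-s y y<s∸x)) (∑-cong x λ y _ → cong 𝟙 (above-s y)) ⟩
  (∑[ y < s ∸ x ] 𝟙 (y <ᵇ K ∸ x)) + (∑[ y < x ] 𝟙 (y <ᵇ K))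
    ≡⟨ cong₂ _+_ (trans (∑-𝟙-< (s ∸ x) (K ∸ x)) (m≥n⇒m⊓n≡n (∸-monoˡ-≤ x K≤s))) (∑-𝟙-< x K) ⟩
  (K ∸ x) + (x ⊓ K)
    ≡⟨ +-comm (K ∸ x) (x ⊓ K) ⟩
  x ⊓ K + (K ∸ x)
    ≡⟨ m⊓n+n∸m≡n x K ⟩
  K ∎
  where
  open ≡-Reasoning
  below-s : ∀ y → y < s ∸ x → window s K (x + y) ≡ (y <ᵇ K ∸ x)
  below-s y y<s∸x = trans (cong (λ b → (x + y <ᵇ K) ∨ (not b ∧ (x + y <ᵇ s + K)))
                                (<ᵇ-true (subst (x + y <_) (m+[n∸m]≡n x≤s) (+-monoʳ-< x y<s∸x))))
                          (trans (∨-identityʳ (x + y <ᵇ K)) (+-<ᵇ-∸ x y K))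
  above-s : ∀ y → window s K (x + (s ∸ x + y)) ≡ (y <ᵇ K)
  above-s y rewrite sym (+-assoc x (s ∸ x) y) | m+[n∸m]≡n x≤s
                  | <ᵇ-false {s + y} {K} (≤-trans K≤s (m≤m+n s y)) | <ᵇ-false {s + y} {s} (m≤m+n s y)
                  = +-<ᵇ s y K

module Circulant (s o k r : ℕ) (k<s : k < s) (r≤s : r ≤ s) where

  K : ℕ → ℕ
  K x = k + 𝟙 (x <ᵇ r)

  K≤1+k : ∀ x → K x ≤ suc k
  K≤1+k x = ≤-trans (+-monoʳ-≤ k (𝟙≤1 (x <ᵇ r))) (≤-reflexive (+-comm k 1))

  R : ℕ → ℕ → Bool
  R x y = (y <ᵇ s) ∧ window s (K x) (x + y)

  open Bipartite s (s + o) R public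

  row-R : ∀ x → x < s → ∑[ y < s + o ] 𝟙 (R x y) ≡ K x
  row-R x x<s = begin
    ∑[ y < s + o ] 𝟙 (R x y)
      ≡⟨ ∑-+ s o _ ⟩
    (∑[ y < s ] 𝟙 (R x y)) + (∑[ z < o ] 𝟙 (R x (s + z)))
      ≡⟨ cong₂ _+_ (∑-cong s λ y y<s → cong (λ b → 𝟙 (b ∧ window s (K x) (x + y))) (<ᵇ-true y<s))
                   (∑-zero o λ z _ → cong (λ b → 𝟙 (b ∧ window s (K x) (x + (s + z)))) (<ᵇ-false (m≤m+n s z))) ⟩
    (∑[ y < s ] 𝟙 (window s (K x) (x + y))) + 0
      ≡⟨ +-identityʳ _ ⟩
    ∑[ y < s ] 𝟙 (window s (K x) (x + y))
      ≡⟨ ∑-window s (K x) x (<⇒≤ x<s) (≤-trans (K≤1+k x) k<s) ⟩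
    K x ∎
    where open ≡-Reasoning

  column-R-≤ : ∀ y → ∑[ x < s ] 𝟙 (R x y) ≤ suc k
  column-R-≤ y with y <ᵇ s in y<s
  ... | false = ≤-trans (≤-reflexive (∑-zero s λ _ _ → refl)) z≤n
  ... | true  = ≤-trans
    (∑-mono-≤ s λ x _ → 𝟙-mono-≤ (subst (T ∘ window s (suc k)) (+-comm x y) ∘ window-mono s (x + y) (K≤1+k x)))
    (≤-reflexive (∑-window s (suc k) y (<⇒≤ (<ᵇ⇒< y s (subst T (sym y<s) _))) k<s))

  edgeCount-circulant : edgeCount (s + (s + o)) bipartite ≡ s * k + r
  edgeCount-circulant = begin
    edgeCount (s + (s + o)) bipartite            ≡⟨ edgeCount-bipartite ⟩
    ∑[ x < s ] ∑[ y < s + o ] 𝟙 (R x y)          ≡⟨ ∑-cong s row-R ⟩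
    ∑[ x < s ] (k + 𝟙 (x <ᵇ r))                  ≡⟨ ∑-distrib-+ s (λ _ → k) _ ⟩
    (∑[ x < s ] k) + (∑[ x < s ] 𝟙 (x <ᵇ r))     ≡⟨ cong₂ _+_ (∑-const s k) (trans (∑-𝟙-< s r) (m≥n⇒m⊓n≡n r≤s)) ⟩
    s * k + r                                     ∎
    where open ≡-Reasoning

  degree-circulant-≤ : ∀ u → u < s + (s + o) → degree (s + (s + o)) bipartite u ≤ suc k
  degree-circulant-≤ = degree-bipartite-≤ (suc k)
    (λ x x<s → ≤-trans (≤-reflexive (row-R x x<s)) (K≤1+k x))
    (λ y _ → column-R-≤ y)

halve : ∀ n → Σ ℕ λ h → Σ ℕ λ e → e ≤ 1 × n ≡ h + (h + e)
halve zero          = 0 , 0 , z≤n , refl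
halve (suc zero)    = 0 , 1 , ≤-refl , refl
halve (suc (suc n)) with h , e , e≤1 , refl ← halve n = suc h , e , e≤1 , cong suc (sym (+-suc h (h + e)))

[m*4+r]/4≡m : ∀ m r → r < 4 → (m * 4 + r) / 4 ≡ m
[m*4+r]/4≡m m r r<4 = begin
  (m * 4 + r) / 4        ≡⟨ +-distrib-/ (m * 4) r (subst (_< 4) (sym (cong₂ _+_ (m*n%n≡0 m 4) (m<n⇒m%n≡m r<4))) r<4) ⟩
  m * 4 / 4 + r / 4      ≡⟨ cong₂ _+_ (m*n/n≡m m 4) (m<n⇒m/n≡0 r<4) ⟩
  m + 0                  ≡⟨ +-identityʳ m ⟩
  m                      ∎
  where open ≡-Reasoning

balancedSplit : ∀ n → Σ ℕ λ h → Σ ℕ λ s → Σ ℕ λ o →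
  n ≡ h + (s + (s + o)) × n * n / 4 ≡ h * (s + (s + o)) × h ≤ s + (s + o) × o ≤ 1
balancedSplit n with h , e , e≤1 , refl ← halve n with s , o , o≤1 , m≡ ← halve (h + e) =
  h , s , o , cong (h +_) m≡ , trans n²/4 (cong (h *_) m≡) , subst (h ≤_) m≡ (m≤m+n h e) , o≤1
  where
  n²/4 : (h + (h + e)) * (h + (h + e)) / 4 ≡ h * (h + e)
  n²/4 = trans (cong (_/ 4) (square h e)) ([m*4+r]/4≡m (h * (h + e)) (e * e) (s≤s (≤-trans (*-mono-≤ e≤1 e≤1) (s≤s z≤n))))
    where
    square : ∀ h e → (h + (h + e)) * (h + (h + e)) ≡ h * (h + e) * 4 + e * e
    square = solve-∀

balanced⇒n≤4s+2 : ∀ h s o → h ≤ s + (s + o) → o ≤ 1 → h + (s + (s + o)) ≤ 4 * s + 2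
balanced⇒n≤4s+2 h s o h≤m o≤1 = begin
  h + (s + (s + o))             ≤⟨ +-mono-≤ (≤-trans h≤m m≤) m≤ ⟩
  s + (s + 1) + (s + (s + 1))   ≡⟨ double s ⟩
  4 * s + 2                     ∎
  where
  open ≤-Reasoning
  m≤ : s + (s + o) ≤ s + (s + 1)
  m≤ = +-monoʳ-≤ s (+-monoʳ-≤ s o≤1)
  double : ∀ s → s + (s + 1) + (s + (s + 1)) ≡ 4 * s + 2
  double = solve-∀

32≤4s+2⇒8≤s : ∀ {n s} → 32 ≤ n → n ≤ 4 * s + 2 → 8 ≤ s
32≤4s+2⇒8≤s 32≤n n≤4s+2 = ≮⇒≥ λ s<8 →
  ≤⇒≯ (≤-trans 32≤n (≤-trans n≤4s+2 (+-monoˡ-≤ 2 (*-monoʳ-≤ 4 (≤-pred s<8))))) (m<m+n 30 z<s)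

balanced⇒4h≤9s : ∀ h s o → 4 ≤ s → h ≤ s + (s + o) → o ≤ 1 → 4 * h ≤ 9 * s
balanced⇒4h≤9s h s o 4≤s h≤m o≤1 = begin
  4 * h              ≤⟨ *-monoʳ-≤ 4 (≤-trans h≤m (+-monoʳ-≤ s (+-monoʳ-≤ s o≤1))) ⟩
  4 * (s + (s + 1))  ≡⟨ expand s ⟩
  8 * s + 4          ≤⟨ +-monoʳ-≤ (8 * s) 4≤s ⟩
  8 * s + s          ≡⟨ collect s ⟩
  9 * s              ∎
  where
  open ≤-Reasoning
  expand : ∀ s → 4 * (s + (s + 1)) ≡ 8 * s + 4
  expand = solve-∀
  collect : ∀ s → 8 * s + s ≡ 9 * s
  collect = solve-∀

surplus<square : ∀ n s q → 8 ≤ s → n ≤ 4 * s + 2 → 20 * q ≤ n * n → q + 1 < s * s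
surplus<square n s q 8≤s n≤4s+2 20q≤n² with s ∸ 8 | m+[n∸m]≡n 8≤s
... | u | refl =
  subst (_≤ (8 + u) * (8 + u)) (+-suc q 1) (*-cancelˡ-≤ 20 (begin
    20 * (q + 2)                                              ≡⟨ *-distribˡ-+ 20 q 2 ⟩
    20 * q + 40                                               ≤⟨ +-monoˡ-≤ 40 (≤-trans 20q≤n² (*-mono-≤ n≤4s+2 n≤4s+2)) ⟩
    (4 * (8 + u) + 2) * (4 * (8 + u) + 2) + 40                ≤⟨ m≤m+n _ (4 * (21 + 12 * u + u * u)) ⟩
    (4 * (8 + u) + 2) * (4 * (8 + u) + 2) + 40 + 4 * (21 + 12 * u + u * u) ≡⟨ identity u ⟩
    20 * ((8 + u) * (8 + u))                                  ∎))
  where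
  open ≤-Reasoning
  -- 4 (21 + 12 u + u²) = 4 s² - 16 s - 44 for s = 8 + u.
  identity : ∀ u → (4 * (8 + u) + 2) * (4 * (8 + u) + 2) + 40 + 4 * (21 + 12 * u + u * u) ≡ 20 * ((8 + u) * (8 + u))
  identity = solve-∀

bowtie-arithmetic : ∀ h m s k M → 4 * h ≤ 9 * s → h ≤ m → s * k ≤ M →
  4 * (h * (M * M) + h * h * (k * (2 * M))) ≤ M * M * (13 * (h + m) + 52)
bowtie-arithmetic h m s k M 4h≤9s h≤m sk≤M = begin
  4 * (h * (M * M) + h * h * (k * (2 * M)))       ≡⟨ regroup h k M ⟩
  4 * h * (M * M) + (2 * h) * ((4 * h) * k) * M   ≤⟨ +-mono-≤ (*-monoˡ-≤ (M * M) (*-monoʳ-≤ 4 h≤n))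
                                                              (*-monoˡ-≤ M (*-mono-≤ 2h≤n (*-monoˡ-≤ k 4h≤9s))) ⟩
  4 * n * (M * M) + n * ((9 * s) * k) * M         ≡⟨ regroup′ n s k M ⟩
  4 * n * (M * M) + 9 * n * (s * k) * M           ≤⟨ +-monoʳ-≤ (4 * n * (M * M)) (*-monoˡ-≤ M (*-monoʳ-≤ (9 * n) sk≤M)) ⟩
  4 * n * (M * M) + 9 * n * M * M                 ≡⟨ collect n M ⟩
  M * M * (13 * n)                                ≤⟨ *-monoʳ-≤ (M * M) (m≤m+n (13 * n) 52) ⟩
  M * M * (13 * n + 52)                           ∎
  where
  open ≤-Reasoning
  n = h + m
  h≤n : h ≤ n
  h≤n = m≤m+n h m
  2h≤n : 2 * h ≤ n
  2h≤n = +-monoʳ-≤ h (≤-trans (≤-reflexive (+-identityʳ h)) h≤m)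
  regroup : ∀ h k M → 4 * (h * (M * M) + h * h * (k * (2 * M))) ≡ 4 * h * (M * M) + (2 * h) * ((4 * h) * k) * M
  regroup = solve-∀
  regroup′ : ∀ n s k M → 4 * n * (M * M) + n * ((9 * s) * k) * M ≡ 4 * n * (M * M) + 9 * n * (s * k) * M
  regroup′ = solve-∀
  collect : ∀ n M → 4 * n * (M * M) + 9 * n * M * M ≡ M * M * (13 * n)
  collect = solve-∀

bowtie-sparse-graph : ∀ h s o M → 4 * h ≤ 9 * s → h ≤ s + (s + o) → M < s * s →
  Σ (Graph (h + (s + (s + o)))) λ G →
    (edges G ≡ h * (s + (s + o)) + M) × (4 * bowties G ≤ M * M * (13 * (h + (s + (s + o))) + 52))
bowtie-sparse-graph h s o M 4h≤9s h≤m M<s² = toGraph (h + m) join , edges≡ , bowties≤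
  where
  m = s + (s + o)
  instance
    s≢0 : NonZero s
    s≢0 = m*n≢0⇒m≢0 s {{>-nonZero (≤-<-trans z≤n M<s²)}}
  k r : ℕ
  k = M / s
  r = M % s
  M≡sk+r : M ≡ s * k + r
  M≡sk+r = trans (m≡m%n+[m/n]*n M s) (trans (+-comm r (k * s)) (cong (_+ r) (*-comm k s)))
  sk≤M : s * k ≤ M
  sk≤M = subst (s * k ≤_) (sym M≡sk+r) (m≤m+n (s * k) r)
  open Circulant s o k r (*-cancelˡ-< s k s (≤-<-trans sk≤M M<s²)) (<⇒≤ (m%n<n M s))
  open Join h m bipartite
  edges≡ : edges (toGraph (h + m) join) ≡ h * m + M
  edges≡ = trans (edges-toGraph (h + m) join) (trans edgeCount-join (cong (h * m +_) (trans edgeCount-circulant (sym M≡sk+r))))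
  bowties≤ : 4 * bowties (toGraph (h + m) join) ≤ M * M * (13 * (h + m) + 52)
  bowties≤ = begin
    4 * bowties (toGraph (h + m) join)
      ≡⟨ cong (4 *_) (bowties-toGraph (h + m) join) ⟩
    4 * (∑[ c < h + m ] bowtiesAt (h + m) join c)
      ≤⟨ *-monoʳ-≤ 4 (bowties-join-≤ bipartite-triangleFree) ⟩
    4 * (h * (e * e) + h * h * (∑[ u < m ] degree m bipartite u * (degree m bipartite u ∸ 1)))
      ≤⟨ *-monoʳ-≤ 4 (+-monoʳ-≤ (h * (e * e)) (*-monoʳ-≤ (h * h) (∑-degree*[degree∸1]-≤ m bipartite k degree-circulant-≤))) ⟩
    4 * (h * (e * e) + h * h * (k * (2 * e)))
      ≡⟨ cong (λ e → 4 * (h * (e * e) + h * h * (k * (2 * e)))) (trans edgeCount-circulant (sym M≡sk+r)) ⟩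
    4 * (h * (M * M) + h * h * (k * (2 * M)))
      ≤⟨ bowtie-arithmetic h m s k M 4h≤9s h≤m sk≤M ⟩
    M * M * (13 * (h + m) + 52) ∎
    where
    open ≤-Reasoning
    e = edgeCount m bipartite

lemma3p2 : Σ ℕ λ N → (n : ℕ) → n ≥ N → (q : ℕ) → 20 * q ≤ n * n →
    Σ (Graph n) λ G → (edges G ≡ exBowtie n + q) × (4 * bowties G ≤ (q + 1) * (q + 1) * (13 * n + 52))
lemma3p2 = 32 , witness
  where
  witness : (n : ℕ) → n ≥ 32 → (q : ℕ) → 20 * q ≤ n * n →
    Σ (Graph n) λ G → (edges G ≡ exBowtie n + q) × (4 * bowties G ≤ (q + 1) * (q + 1) * (13 * n + 52))
  witness n 32≤n q 20q≤n² with h , s , o , refl , n²/4≡hm , h≤m , o≤1 ← balancedSplit n =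
    let G , edges≡ , bowties≤ = bowtie-sparse-graph h s o (q + 1) (balanced⇒4h≤9s h s o 4≤s h≤m o≤1) h≤m
                                  (surplus<square _ s q 8≤s n≤4s+2 20q≤n²)
    in G , trans edges≡ edges-over-extremal , bowties≤
    where
    n≤4s+2 = balanced⇒n≤4s+2 h s o h≤m o≤1
    8≤s = 32≤4s+2⇒8≤s 32≤n n≤4s+2
    4≤s = ≤-trans (m≤m+n 4 4) 8≤s
    edges-over-extremal : h * (s + (s + o)) + (q + 1) ≡ exBowtie (h + (s + (s + o))) + q
    edges-over-extremal = begin
      h * (s + (s + o)) + (q + 1)   ≡⟨ cong (h * (s + (s + o)) +_) (+-comm q 1) ⟩
      h * (s + (s + o)) + (1 + q)   ≡⟨ sym (+-assoc (h * (s + (s + o))) 1 q) ⟩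
      h * (s + (s + o)) + 1 + q     ≡⟨ cong (λ x → x + 1 + q) (sym n²/4≡hm) ⟩
      exBowtie (h + (s + (s + o))) + q ∎
      where open ≡-Reasoning
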